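{- For matroids $M$ on $S$ and $N$ on $T$ with $S\cap T=\emptyset$, the collection of bases of $M\mathbin{\Box} N$ is $$\{A\subseteq S\cup T:\ A\cap S\text{ is independent in }M,\ A\cap T\text{ spans }N,\ \text{and }\lambda_M(A\cap S)=\nu_N(A\cap T)\}.$$
   Context: For a matroid $M$ on $S$, $\rho(M)$ is its rank, $\nu_M(A)=|A|-\rho_M(A)$ and $\lambda_M(A)=\rho(M)-\rho_M(A)$. The free product $M\mathbin{\Box} N$ is the matroid on $S\cup T$ whose independent sets are the $A\subseteq S\cup T$ such that $A\cap S$ is independent in $M$ and $\lambda_M(A\cap S)\geq\nu_N(A\cap T)$. -}

module Defs where

open import Data.Nat using (ℕ; zero; suc; _+_; _∸_; _⊔_; _<_)
open import Data.Bool using (Bool)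
open import Data.Fin using (Fin)
open import Data.Fin.Subset using (Subset; _⊆_; _∈_; _∉_; _∪_; ⁅_⁆; ∣_∣; inside; outside)
open import Data.Fin.Subset.Properties using (_⊆?_)
open import Data.List using (List; []; _∷_; [_]; map; _++_; filter; foldr)
open import Data.Vec using (Vec; take; drop) renaming (_∷_ to _∷ᵥ_; [] to []ᵥ)
open import Data.Product using (Σ; ∃; _×_; _,_)
open import Relation.Nullary using (¬_; Dec)
open import Relation.Nullary.Decidable using (_×-dec_)
open import Relation.Unary using (Decidable)
open import Relation.Binary.PropositionalEquality using (_≡_)

record Matroid (n : ℕ) : Set₁ where
  field
    Indep    : Subset n → Set
    indep?   : Decidable Indep
    indep-∅  : Indep Data.Fin.Subset.⊥
    indep-⊆  : ∀ {A B} → B ⊆ A → Indep A → Indep B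
    augment  : ∀ {A B} → Indep A → Indep B → ∣ A ∣ < ∣ B ∣ →
               ∃ λ (x : Fin n) → x ∈ B × x ∉ A × Indep (A ∪ ⁅ x ⁆)

open Matroid public

allSubsets : ∀ n → List (Subset n)
allSubsets zero    = [ []ᵥ ]
allSubsets (suc n) = map (outside ∷ᵥ_) (allSubsets n) ++ map (inside ∷ᵥ_) (allSubsets n)

maximum : List ℕ → ℕ
maximum = foldr _⊔_ 0

rk : ∀ {n} → Matroid n → Subset n → ℕ
rk {n} M A = maximum (map ∣_∣ (filter (λ B → (B ⊆? A) ×-dec indep? M B) (allSubsets n)))

rank : ∀ {n} → Matroid n → ℕ
rank {n} M = rk M Data.Fin.Subset.⊤

ν : ∀ {n} → Matroid n → Subset n → ℕ
ν M A = ∣ A ∣ ∸ rk M A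

λM : ∀ {n} → Matroid n → Subset n → ℕ
λM M A = rank M ∸ rk M A

Spans : ∀ {n} → Matroid n → Subset n → Set
Spans M A = rk M A ≡ rank M

-- Ground set S ∪ T is modelled as Fin (m + n): S = first m elements,
-- T = last n elements (so S ∩ T = ∅).  A ∩ S = take m A, A ∩ T = drop m A.
FreeProductIndep : ∀ {m n} → Matroid m → Matroid n → Subset (m + n) → Set
FreeProductIndep {m} M N A =
  Indep M (take m A) × ν N (drop m A) Data.Nat.≤ λM M (take m A)

IsBasis : ∀ {k} → (Subset k → Set) → Subset k → Set
IsBasis I A = I A × (∀ B → A ⊆ B → I B → B ≡ A)

{-# OPTIONS --safe #-}
module Submission where

-- Write A = I ∪ J with I ⊆ S, J ⊆ T.  For independent A, |J| - ρ_N(J) ≤ ρ(M) - |I| gives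
-- |A| ≤ ρ(M) + ρ_N(J) ≤ ρ(M) + ρ(N), with equality exactly when J spans N and
-- λ_M(I) = ν_N(J); independent sets of this maximum size are bases.  Conversely, if J
-- does not span N, adding to J an element that raises its rank keeps ν_N(J), and if
-- ν_N(J) < λ_M(I), then I is not a basis of M and augmenting it lowers λ_M(I) by one;
-- either way A has a proper independent extension.

open import Defs
open import Data.Nat using (ℕ; zero; suc; _+_; _∸_; _≤_; _<_; pred; s≤s)
open import Data.Nat.Properties
open import Data.Fin using (Fin) renaming (zero to fzero; suc to fsuc)
open import Data.Fin.Subset using (Subset; _⊆_; _∈_; _∉_; _∪_; ⁅_⁆; ∣_∣; inside; outside; ⊤) renaming (⊥ to ∅)
open import Data.Fin.Subset.Properties
  using (_⊆?_; drop-∷-⊆; ⊆⊤; ⊆-refl; ⊆-min; ∣⊥∣≡0; p⊆q⇒∣p∣≤∣q∣; p⊆p∪q; x∈p∪q⁺; x∈p∪q⁻; x∈⁅x⁆; x∈⁅y⁆⇒x≡y; ∪-identityʳ)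
open import Data.Vec using (Vec; []; _∷_; _++_; take; drop; here; there)
open import Data.Vec.Properties using (take++drop≡id; ++-injectiveˡ; ++-injectiveʳ)
open import Data.List as List using (map; filter)
open import Data.List.Relation.Unary.Any as Any using ()
open import Data.List.Membership.Propositional using () renaming (_∈_ to _∈ₗ_)
open import Data.List.Membership.Propositional.Properties using (∈-map⁺; ∈-map⁻; ∈-filter⁺; ∈-filter⁻; ∈-++⁺ˡ; ∈-++⁺ʳ)
open import Data.Product using (_×_; _,_; ∃; proj₁; proj₂)
open import Data.Sum using (_⊎_; inj₁; inj₂)
open import Function using (_∘_; id)
open import Function.Bundles using (_⇔_; mk⇔; Equivalence)
open import Relation.Nullary using (¬_; contradiction)
open import Relation.Nullary.Decidable using (_×-dec_)
open import Relation.Unary using (Decidable)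
open import Relation.Binary.PropositionalEquality using (_≡_; refl; sym; trans; cong; subst; module ≡-Reasoning)

open Equivalence using (to; from)

allSubsets-complete : ∀ k (A : Subset k) → A ∈ₗ allSubsets k
allSubsets-complete zero    []            = Any.here refl
allSubsets-complete (suc k) (outside ∷ A) = ∈-++⁺ˡ (∈-map⁺ (outside ∷_) (allSubsets-complete k A))
allSubsets-complete (suc k) (inside ∷ A)  = ∈-++⁺ʳ _ (∈-map⁺ (inside ∷_) (allSubsets-complete k A))

≤-maximum : ∀ {x} xs → x ∈ₗ xs → x ≤ maximum xs
≤-maximum (y List.∷ xs) (Any.here refl) = m≤m⊔n y (maximum xs)
≤-maximum (y List.∷ xs) (Any.there x∈xs) = ≤-trans (≤-maximum xs x∈xs) (m≤n⊔m y (maximum xs))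

maximum-attained : ∀ xs → maximum xs ≡ 0 ⊎ maximum xs ∈ₗ xs
maximum-attained List.[]       = inj₁ refl
maximum-attained (y List.∷ xs) with ⊔-sel y (maximum xs)
... | inj₁ max≡y = inj₂ (Any.here max≡y)
... | inj₂ max≡max with maximum-attained xs
...   | inj₁ max≡0  = inj₁ (trans max≡max max≡0)
...   | inj₂ max∈xs = inj₂ (Any.there (subst (_∈ₗ xs) (sym max≡max) max∈xs))

module _ {k : ℕ} where

  x∈p∪⁅x⁆ : ∀ {x : Fin k} (p : Subset k) → x ∈ p ∪ ⁅ x ⁆
  x∈p∪⁅x⁆ {x} _ = x∈p∪q⁺ (inj₂ (x∈⁅x⁆ x))

  x∈p⇒⁅x⁆⊆p : ∀ {x : Fin k} {p} → x ∈ p → ⁅ x ⁆ ⊆ p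
  x∈p⇒⁅x⁆⊆p {x} {p} x∈p y∈⁅x⁆ = subst (_∈ p) (sym (x∈⁅y⁆⇒x≡y x y∈⁅x⁆)) x∈p

  ∪-least : ∀ {p q r : Subset k} → p ⊆ r → q ⊆ r → p ∪ q ⊆ r
  ∪-least {p} {q} p⊆r q⊆r x∈p∪q with x∈p∪q⁻ p q x∈p∪q
  ... | inj₁ x∈p = p⊆r x∈p
  ... | inj₂ x∈q = q⊆r x∈q

  ∪-monoˡ-⊆ : ∀ {p q : Subset k} r → p ⊆ q → p ∪ r ⊆ q ∪ r
  ∪-monoˡ-⊆ r p⊆q = ∪-least (λ x∈p → p⊆p∪q r (p⊆q x∈p)) (x∈p∪q⁺ ∘ inj₂)

x∉p⇒∣p∪⁅x⁆∣≡1+∣p∣ : ∀ {k} {x : Fin k} {p : Subset k} → x ∉ p → ∣ p ∪ ⁅ x ⁆ ∣ ≡ suc ∣ p ∣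
x∉p⇒∣p∪⁅x⁆∣≡1+∣p∣ {x = fzero}  {outside ∷ p} _   = cong (suc ∘ ∣_∣) (∪-identityʳ p)
x∉p⇒∣p∪⁅x⁆∣≡1+∣p∣ {x = fzero}  {inside ∷ p}  x∉p = contradiction here x∉p
x∉p⇒∣p∪⁅x⁆∣≡1+∣p∣ {x = fsuc x} {outside ∷ p} x∉p = x∉p⇒∣p∪⁅x⁆∣≡1+∣p∣ (x∉p ∘ there)
x∉p⇒∣p∪⁅x⁆∣≡1+∣p∣ {x = fsuc x} {inside ∷ p}  x∉p = cong suc (x∉p⇒∣p∪⁅x⁆∣≡1+∣p∣ (x∉p ∘ there))

p⊆q∧∣q∣≤∣p∣⇒p≡q : ∀ {k} {p q : Subset k} → p ⊆ q → ∣ q ∣ ≤ ∣ p ∣ → p ≡ q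
p⊆q∧∣q∣≤∣p∣⇒p≡q {p = []}          {[]}          _   _     = refl
p⊆q∧∣q∣≤∣p∣⇒p≡q {p = outside ∷ p} {outside ∷ q} p⊆q ∣q∣≤∣p∣ = cong (outside ∷_) (p⊆q∧∣q∣≤∣p∣⇒p≡q (drop-∷-⊆ p⊆q) ∣q∣≤∣p∣)
p⊆q∧∣q∣≤∣p∣⇒p≡q {p = inside ∷ p}  {inside ∷ q}  p⊆q ∣q∣≤∣p∣ = cong (inside ∷_) (p⊆q∧∣q∣≤∣p∣⇒p≡q (drop-∷-⊆ p⊆q) (≤-pred ∣q∣≤∣p∣))
p⊆q∧∣q∣≤∣p∣⇒p≡q {p = outside ∷ p} {inside ∷ q}  p⊆q ∣q∣≤∣p∣ = contradiction ∣q∣≤∣p∣ (<⇒≱ (s≤s (p⊆q⇒∣p∣≤∣q∣ (drop-∷-⊆ p⊆q))))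
p⊆q∧∣q∣≤∣p∣⇒p≡q {p = inside ∷ p}  {outside ∷ q} p⊆q _ with p⊆q here
... | ()

take-++ : ∀ {a} {A : Set a} {m n} (xs : Vec A m) (ys : Vec A n) → take m (xs ++ ys) ≡ xs
take-++ []       ys = refl
take-++ (x ∷ xs) ys = cong (x ∷_) (take-++ xs ys)

drop-++ : ∀ {a} {A : Set a} {m n} (xs : Vec A m) (ys : Vec A n) → drop m (xs ++ ys) ≡ ys
drop-++ []       ys = refl
drop-++ (x ∷ xs) ys = drop-++ xs ys

∣p++q∣≡∣p∣+∣q∣ : ∀ {m n} (p : Subset m) (q : Subset n) → ∣ p ++ q ∣ ≡ ∣ p ∣ + ∣ q ∣
∣p++q∣≡∣p∣+∣q∣ []            q = refl
∣p++q∣≡∣p∣+∣q∣ (outside ∷ p) q = ∣p++q∣≡∣p∣+∣q∣ p q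
∣p++q∣≡∣p∣+∣q∣ (inside ∷ p)  q = cong suc (∣p++q∣≡∣p∣+∣q∣ p q)

++⁺-⊆ : ∀ {m n} {p p′ : Subset m} {q q′ : Subset n} → p ⊆ p′ → q ⊆ q′ → p ++ q ⊆ p′ ++ q′
++⁺-⊆ {p = []}    {[]}     _    q⊆q′ x∈q        = q⊆q′ x∈q
++⁺-⊆ {p = _ ∷ _} {_ ∷ _}  p⊆p′ _    here       with p⊆p′ here
... | here = here
++⁺-⊆ {p = _ ∷ _} {_ ∷ _}  p⊆p′ q⊆q′ (there x∈) = there (++⁺-⊆ (drop-∷-⊆ p⊆p′) q⊆q′ x∈)

module _ {k} (M : Matroid k) where

  private
    indepSubsetOf? : ∀ A → Decidable (λ B → B ⊆ A × Indep M B)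
    indepSubsetOf? A B = (B ⊆? A) ×-dec indep? M B

  ∣I∣≤rk : ∀ {I A} → I ⊆ A → Indep M I → ∣ I ∣ ≤ rk M A
  ∣I∣≤rk {I} {A} I⊆A indI = ≤-maximum _ (∈-map⁺ ∣_∣
    (∈-filter⁺ (indepSubsetOf? A) (allSubsets-complete k I) (I⊆A , indI)))

  rk-attained : ∀ A → ∃ λ I → I ⊆ A × Indep M I × ∣ I ∣ ≡ rk M A
  rk-attained A with maximum-attained (map ∣_∣ (filter (indepSubsetOf? A) (allSubsets k)))
  ... | inj₁ rk≡0 = ∅ , ⊆-min A , indep-∅ M , trans (∣⊥∣≡0 k) (sym rk≡0)
  ... | inj₂ rk∈ with ∈-map⁻ ∣_∣ rk∈
  ...   | I , I∈ , rk≡∣I∣ with ∈-filter⁻ (indepSubsetOf? A) {xs = allSubsets k} I∈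
  ...     | _ , I⊆A , indI = I , I⊆A , indI , sym rk≡∣I∣

  rk≤∣A∣ : ∀ A → rk M A ≤ ∣ A ∣
  rk≤∣A∣ A with rk-attained A
  ... | I , I⊆A , _ , ∣I∣≡rk = subst (_≤ ∣ A ∣) ∣I∣≡rk (p⊆q⇒∣p∣≤∣q∣ I⊆A)

  rk≤rank : ∀ A → rk M A ≤ rank M
  rk≤rank A with rk-attained A
  ... | I , _ , indI , ∣I∣≡rk = subst (_≤ rank M) ∣I∣≡rk (∣I∣≤rk ⊆⊤ indI)

  indep⇒rk≡∣I∣ : ∀ {I} → Indep M I → rk M I ≡ ∣ I ∣
  indep⇒rk≡∣I∣ {I} indI = ≤-antisym (rk≤∣A∣ I) (∣I∣≤rk ⊆-refl indI)

  augment-to-rank : ∀ {I} → Indep M I → ∣ I ∣ < rank M → ∃ λ x → x ∉ I × Indep M (I ∪ ⁅ x ⁆)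
  augment-to-rank {I} indI ∣I∣<rank with rk-attained ⊤
  ... | B , _ , indB , ∣B∣≡rank with augment M indI indB (subst (∣ I ∣ <_) (sym ∣B∣≡rank) ∣I∣<rank)
  ...   | x , _ , x∉I , indIx = x , x∉I , indIx

  rk-increase : ∀ {A} → rk M A < rank M → ∃ λ x → x ∉ A × suc (rk M A) ≤ rk M (A ∪ ⁅ x ⁆)
  rk-increase {A} rk<rank with rk-attained A
  ... | I , I⊆A , indI , ∣I∣≡rk with augment-to-rank indI (subst (_< rank M) (sym ∣I∣≡rk) rk<rank)
  ...   | x , x∉I , indIx = x , x∉A , ≤-trans rk<∣Ix∣ (∣I∣≤rk (∪-monoˡ-⊆ ⁅ x ⁆ I⊆A) indIx)
    where
      rk<∣Ix∣ : suc (rk M A) ≤ ∣ I ∪ ⁅ x ⁆ ∣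
      rk<∣Ix∣ = ≤-reflexive (trans (cong suc (sym ∣I∣≡rk)) (sym (x∉p⇒∣p∪⁅x⁆∣≡1+∣p∣ x∉I)))

      x∉A : x ∉ A
      x∉A x∈A = <⇒≱ rk<∣Ix∣ (∣I∣≤rk (∪-least I⊆A (x∈p⇒⁅x⁆⊆p x∈A)) indIx)

  λM-∪⁅x⁆ : ∀ {I x} → x ∉ I → Indep M I → Indep M (I ∪ ⁅ x ⁆) → λM M (I ∪ ⁅ x ⁆) ≡ pred (λM M I)
  λM-∪⁅x⁆ {I} {x} x∉I indI indIx = begin
    rank M ∸ rk M (I ∪ ⁅ x ⁆) ≡⟨ cong (rank M ∸_) (trans (indep⇒rk≡∣I∣ indIx) (x∉p⇒∣p∪⁅x⁆∣≡1+∣p∣ x∉I)) ⟩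
    rank M ∸ suc ∣ I ∣        ≡⟨ sym (pred[m∸n]≡m∸[1+n] (rank M) ∣ I ∣) ⟩
    pred (rank M ∸ ∣ I ∣)     ≡⟨ cong (pred ∘ (rank M ∸_)) (sym (indep⇒rk≡∣I∣ indI)) ⟩
    pred (λM M I)             ∎
    where open ≡-Reasoning

  ν-∪⁅x⁆ : ∀ {A x} → x ∉ A → suc (rk M A) ≤ rk M (A ∪ ⁅ x ⁆) → ν M (A ∪ ⁅ x ⁆) ≤ ν M A
  ν-∪⁅x⁆ x∉A rk-grows = ∸-mono (≤-reflexive (x∉p⇒∣p∪⁅x⁆∣≡1+∣p∣ x∉A)) rk-grows

maximum-size⇒isBasis : ∀ {k} {P : Subset k → Set} {A} → P A → (∀ {B} → P B → ∣ B ∣ ≤ ∣ A ∣) → IsBasis P A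
maximum-size⇒isBasis PA bound = PA , λ B A⊆B PB → sym (p⊆q∧∣q∣≤∣p∣⇒p≡q A⊆B (bound PB))

module _ {m n} {P : Subset (m + n) → Set} {I : Subset m} {J : Subset n} (basis : IsBasis P (I ++ J)) where

  isBasis-++⇒¬extendˡ : ∀ {x} → x ∉ I → ¬ P ((I ∪ ⁅ x ⁆) ++ J)
  isBasis-++⇒¬extendˡ {x} x∉I PIxJ = x∉I (subst (x ∈_) Ix≡I (x∈p∪⁅x⁆ I))
    where
      Ix≡I : I ∪ ⁅ x ⁆ ≡ I
      Ix≡I = ++-injectiveˡ (I ∪ ⁅ x ⁆) I (proj₂ basis _ (++⁺-⊆ {p = I} {q = J} (p⊆p∪q ⁅ x ⁆) ⊆-refl) PIxJ)

  isBasis-++⇒¬extendʳ : ∀ {x} → x ∉ J → ¬ P (I ++ (J ∪ ⁅ x ⁆))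
  isBasis-++⇒¬extendʳ {x} x∉J PIJx = x∉J (subst (x ∈_) Jx≡J (x∈p∪⁅x⁆ J))
    where
      Jx≡J : J ∪ ⁅ x ⁆ ≡ J
      Jx≡J = ++-injectiveʳ I I (proj₂ basis _ (++⁺-⊆ {p = I} {q = J} ⊆-refl (p⊆p∪q ⁅ x ⁆)) PIJx)

m∸n≤o∸p⇒m+p≤o+n : ∀ {m n o p} → p ≤ o → m ∸ n ≤ o ∸ p → m + p ≤ o + n
m∸n≤o∸p⇒m+p≤o+n {m} {n} {o} {p} p≤o m∸n≤o∸p = begin
  m + p               ≤⟨ +-monoˡ-≤ p (m≤n+m∸n m n) ⟩
  n + (m ∸ n) + p     ≤⟨ +-monoˡ-≤ p (+-monoʳ-≤ n m∸n≤o∸p) ⟩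
  n + (o ∸ p) + p     ≡⟨ +-assoc n (o ∸ p) p ⟩
  n + (o ∸ p + p)     ≡⟨ cong (n +_) (m∸n+n≡m p≤o) ⟩
  n + o               ≡⟨ +-comm n o ⟩
  o + n               ∎
  where open ≤-Reasoning

module _ {m n} (M : Matroid m) (N : Matroid n) where

  FreeProductIndep-++⇔ : ∀ {I J} → FreeProductIndep M N (I ++ J) ⇔ (Indep M I × ν N J ≤ λM M I)
  FreeProductIndep-++⇔ {I} {J} rewrite take-++ I J | drop-++ I J = mk⇔ id id

  FreeProductIndep⇒∣A∣≤rank+rank : ∀ {A} → FreeProductIndep M N A → ∣ A ∣ ≤ rank M + rank N
  FreeProductIndep⇒∣A∣≤rank+rank {A} (indI , ν≤λ) = begin
    ∣ A ∣             ≡⟨ cong ∣_∣ (sym (take++drop≡id m A)) ⟩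
    ∣ I ++ J ∣        ≡⟨ trans (∣p++q∣≡∣p∣+∣q∣ I J) (+-comm ∣ I ∣ ∣ J ∣) ⟩
    ∣ J ∣ + ∣ I ∣     ≡⟨ cong (∣ J ∣ +_) (sym (indep⇒rk≡∣I∣ M indI)) ⟩
    ∣ J ∣ + rk M I    ≤⟨ m∸n≤o∸p⇒m+p≤o+n (rk≤rank M I) ν≤λ ⟩
    rank M + rk N J   ≤⟨ +-monoʳ-≤ (rank M) (rk≤rank N J) ⟩
    rank M + rank N   ∎
    where
      open ≤-Reasoning

      I : Subset m
      I = take m A

      J : Subset n
      J = drop m A

  spans∧λM≡ν⇒rank+rank≤∣I++J∣ : ∀ {I J} → Indep M I → Spans N J → λM M I ≡ ν N J →
                                rank M + rank N ≤ ∣ I ++ J ∣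
  spans∧λM≡ν⇒rank+rank≤∣I++J∣ {I} {J} indI spans λ≡ν = begin
    rank M + rank N   ≡⟨ cong (rank M +_) (sym spans) ⟩
    rank M + rk N J   ≤⟨ m∸n≤o∸p⇒m+p≤o+n (rk≤∣A∣ N J) (≤-reflexive λ≡ν) ⟩
    ∣ J ∣ + rk M I    ≡⟨ cong (∣ J ∣ +_) (indep⇒rk≡∣I∣ M indI) ⟩
    ∣ J ∣ + ∣ I ∣     ≡⟨ trans (+-comm ∣ J ∣ ∣ I ∣) (sym (∣p++q∣≡∣p∣+∣q∣ I J)) ⟩
    ∣ I ++ J ∣        ∎
    where open ≤-Reasoning

  spans∧λM≡ν⇒isBasis : ∀ {I J} → Indep M I → Spans N J → λM M I ≡ ν N J →
                       IsBasis (FreeProductIndep M N) (I ++ J)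
  spans∧λM≡ν⇒isBasis indI spans λ≡ν = maximum-size⇒isBasis
    (from FreeProductIndep-++⇔ (indI , ≤-reflexive (sym λ≡ν)))
    (λ PB → ≤-trans (FreeProductIndep⇒∣A∣≤rank+rank PB) (spans∧λM≡ν⇒rank+rank≤∣I++J∣ indI spans λ≡ν))

  module _ {I : Subset m} {J : Subset n} (basis : IsBasis (FreeProductIndep M N) (I ++ J)) where

    private
      indI : Indep M I
      indI = proj₁ (to FreeProductIndep-++⇔ (proj₁ basis))

      ν≤λ : ν N J ≤ λM M I
      ν≤λ = proj₂ (to FreeProductIndep-++⇔ (proj₁ basis))

    isBasis⇒spans : Spans N J
    isBasis⇒spans = ≤-antisym (rk≤rank N J) (≮⇒≥ rk≮rank)
      where
        rk≮rank : ¬ rk N J < rank N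
        rk≮rank rk<rank with rk-increase N rk<rank
        ... | x , x∉J , rk-grows = isBasis-++⇒¬extendʳ basis x∉J
          (from FreeProductIndep-++⇔ (indI , ≤-trans (ν-∪⁅x⁆ N x∉J rk-grows) ν≤λ))

    isBasis⇒λM≡ν : λM M I ≡ ν N J
    isBasis⇒λM≡ν = ≤-antisym (≮⇒≥ ν≮λ) ν≤λ
      where
        ν≮λ : ¬ ν N J < λM M I
        ν≮λ ν<λ with augment-to-rank M indI ∣I∣<rank
          where
            ∣I∣<rank : ∣ I ∣ < rank M
            ∣I∣<rank = subst (_< rank M) (indep⇒rk≡∣I∣ M indI)
              (m∸n≢0⇒n<m (λ λ≡0 → n≮0 (subst (ν N J <_) λ≡0 ν<λ)))
        ... | x , x∉I , indIx = isBasis-++⇒¬extendˡ basis x∉I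
          (from FreeProductIndep-++⇔ (indIx , ν≤λIx))
          where
            ν≤λIx : ν N J ≤ λM M (I ∪ ⁅ x ⁆)
            ν≤λIx = subst (ν N J ≤_) (sym (λM-∪⁅x⁆ M x∉I indI indIx)) (suc[m]≤n⇒m≤pred[n] ν<λ)

  isBasis-++⇔ : ∀ I J → IsBasis (FreeProductIndep M N) (I ++ J) ⇔ (Indep M I × Spans N J × λM M I ≡ ν N J)
  isBasis-++⇔ I J = mk⇔
    (λ basis → proj₁ (to FreeProductIndep-++⇔ (proj₁ basis)) , isBasis⇒spans basis , isBasis⇒λM≡ν basis)
    (λ (indI , spans , λ≡ν) → spans∧λM≡ν⇒isBasis indI spans λ≡ν)

proposition3p2 : (m n : ℕ) (M : Matroid m) (N : Matroid n) (A : Subset (m + n)) →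
    IsBasis (FreeProductIndep M N) A ⇔
      (Indep M (take m A) × Spans N (drop m A) × λM M (take m A) ≡ ν N (drop m A))
proposition3p2 m n M N A =
  subst (λ X → IsBasis (FreeProductIndep M N) X ⇔ (Indep M I × Spans N J × λM M I ≡ ν N J))
        (take++drop≡id m A) (isBasis-++⇔ M N I J)
  where
    I : Subset m
    I = take m A

    J : Subset n
    J = drop m A
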